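{- Let $1314_{1316}$ be the finite integral relation algebra with atoms $1',a,b,r,\breve{r}$, where $a,b$ are self-converse and $r,\breve{r}$ are distinct converses of each other, in which for diversity atoms $x,y$ we have $1'\le x;y$ iff $y=\breve{x}$, and for diversity atoms $x,y,z$ we have $z\le x;y$ except exactly when $x=y=z=a$ or $x=y=z=b$. Then $1314_{1316}$ has a cyclic group representation over $\mathbb{Z}/71\mathbb{Z}$ (in particular, it is representable on a set of $71$ points).
   Context: A cyclic group representation of a finite integral relation algebra over $\mathbb{Z}/n\mathbb{Z}$ is an assignment of a nonempty set $S_x\subseteq \mathbb{Z}/n\mathbb{Z}\setminus\{0\}$ to each diversity atom $x$ such that the sets $S_x$ partition $\mathbb{Z}/n\mathbb{Z}\setminus\{0\}$, $S_{\breve{x}}=-S_x$, and for all diversity atoms $x,y$, $(S_x+S_y)\setminus\{0\}=\bigcup\{S_z : z \text{ a diversity atom with } z\le x;y\}$. Equivalently, setting $R_{1'}=\{(u,u)\}$ and $R_x=\{(u,v): v-u\in S_x\}$ gives a representation of the algebra on the set $\mathbb{Z}/n\mathbb{Z}$. -}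

module Defs where

open import Data.Nat using (ℕ; NonZero; _+_; _∸_)
open import Data.Nat.DivMod using (_mod_)
open import Data.Fin using (Fin; toℕ; zero)
open import Data.Fin.Subset using (Subset; _∈_; _∉_; Nonempty)
open import Data.Product using (Σ; _×_; ∃; ∃-syntax)
open import Data.Sum using (_⊎_)
open import Relation.Binary.PropositionalEquality using (_≡_; _≢_)
open import Relation.Nullary using (¬_)
open import Function.Bundles using (_⇔_)

module _ {n : ℕ} .{{_ : NonZero n}} where
  _+ₙ_ : Fin n → Fin n → Fin n
  i +ₙ j = (toℕ i + toℕ j) mod n

  -ₙ_ : Fin n → Fin n
  -ₙ i = (n ∸ toℕ i) mod n

  zeroₙ : Fin n
  zeroₙ = 0 mod n

-- A cyclic group representation over ℤ/nℤ of a finite integral relation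
-- algebra whose diversity atoms form the type D, with converse operation
-- conv, and with  Cmp x y z  meaning  z ≤ x;y  (for diversity atoms x y z).
record CyclicGroupRep (n : ℕ) .{{_ : NonZero n}} (D : Set)
                      (conv : D → D) (Cmp : D → D → D → Set) : Set₁ where
  field
    S          : D → Subset n
    nonempty   : ∀ x → Nonempty (S x)
    zero∉      : ∀ x → zeroₙ ∉ S x
    cover      : ∀ (u : Fin n) → u ≢ zeroₙ → ∃[ x ] (u ∈ S x)
    disjoint   : ∀ x y (u : Fin n) → u ∈ S x → u ∈ S y → x ≡ y
    converse   : ∀ x (u : Fin n) → (u ∈ S (conv x)) ⇔ ((-ₙ u) ∈ S x)
    composition : ∀ x y (w : Fin n) → w ≢ zeroₙ →
      (∃[ u ] ∃[ v ] (u ∈ S x × v ∈ S y × w ≡ u +ₙ v))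
        ⇔ (∃[ z ] (Cmp x y z × w ∈ S z))

data Atom : Set where
  a b r r˘ : Atom

conv : Atom → Atom
conv a  = a
conv b  = b
conv r  = r˘
conv r˘ = r

Cmp1314 : Atom → Atom → Atom → Set
Cmp1314 x y z = ¬ ((x ≡ a × y ≡ a × z ≡ a) ⊎ (x ≡ b × y ≡ b × z ≡ b))

{-# OPTIONS --safe #-}
-- A cyclic group representation over ℤ/nℤ amounts to labelling every nonzero
-- residue by a diversity atom (the atom whose set contains it).  The defining
-- conditions then become finitely many statements about the labelling:
-- negation acts on labels as converse, the label of a sum of two nonzero
-- residues lies below the composite of their labels, and every residue whose
-- label lies below x;y is the sum of residues labelled x and y.  For a finite
-- algebra these statements are decidable, so a proposed labelling of ℤ/71ℤ is
-- verified by evaluation.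
module Submission where

open import Defs
open import Data.Bool using (true)
open import Data.Empty using (⊥)
open import Data.Fin using (Fin; zero; suc)
open import Data.Fin.Properties using (all?; any?) renaming (_≟_ to _≟ᶠ_)
open import Data.Fin.Subset using (Subset; _∈_; _∉_)
open import Data.Maybe using (Maybe; just; nothing)
import Data.Maybe as Maybe
open import Data.Maybe.Properties using (just-injective) renaming (≡-dec to ≡-decᴹ)
open import Data.Nat using (ℕ; NonZero)
open import Data.Product using (_×_; _,_; ∃-syntax)
open import Data.Unit using (⊤)
open import Data.Vec using (Vec; _∷_; []; lookup; tabulate)
open import Data.Vec.Properties using (lookup∘tabulate; []=⇒lookup; lookup⇒[]=)
open import Function using (_∘_)
open import Function.Bundles using (_⇔_; mk⇔; Equivalence)
import Function.Properties.Equivalence as ⇔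
open import Level using (0ℓ)
open import Relation.Binary using (DecidableEquality)
open import Relation.Binary.PropositionalEquality
  using (_≡_; _≢_; refl; sym; trans; cong; subst; module ≡-Reasoning)
open import Relation.Nullary using (Dec; yes; no; does; _because_; invert)
open import Relation.Nullary.Decidable
  using (from-yes; dec-true; map′; ¬?; _×-dec_; _⊎-dec_; _→-dec_)
open import Relation.Unary using (Pred; Decidable)

does-true⇒ : ∀ {p} {A : Set p} (a? : Dec A) → does a? ≡ true → A
does-true⇒ (true because [a]) _ = invert [a]

∈-tabulate-does⇔ : ∀ {n p} {P : Pred (Fin n) p} (P? : Decidable P) u →
                   u ∈ tabulate (does ∘ P?) ⇔ P u
∈-tabulate-does⇔ P? u = mk⇔
  (λ u∈ → does-true⇒ (P? u) (trans (sym (lookup∘tabulate (does ∘ P?) u)) ([]=⇒lookup u∈)))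
  (λ Pu → lookup⇒[]= u _ (trans (lookup∘tabulate (does ∘ P?) u) (dec-true (P? u) Pu)))

module _ {n : ℕ} .{{_ : NonZero n}} where
  _-ₙ_ : Fin n → Fin n → Fin n
  w -ₙ u = w +ₙ (-ₙ u)

module CyclicLabelling {n : ℕ} .{{_ : NonZero n}} {D : Set} (_≟ᴰ_ : DecidableEquality D)
                       (conv : D → D) (Cmp : D → D → D → Set) (label : Fin n → Maybe D) where

  _≟ᴹ_ : DecidableEquality (Maybe D)
  _≟ᴹ_ = ≡-decᴹ _≟ᴰ_

  S : D → Subset n
  S x = tabulate (λ u → does (label u ≟ᴹ just x))

  ∈S⇔ : ∀ x u → u ∈ S x ⇔ label u ≡ just x
  ∈S⇔ x = ∈-tabulate-does⇔ (λ u → label u ≟ᴹ just x)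

  Composable : Maybe D → Maybe D → Maybe D → Set
  Composable (just x) (just y) (just z) = Cmp x y z
  Composable _        _        _        = ⊤

  composable-just : ∀ {p q s x y z} → p ≡ just x → q ≡ just y → s ≡ just z →
                    Composable p q s → Cmp x y z
  composable-just refl refl refl xyz = xyz

  Below : D → D → Maybe D → Set
  Below x y (just z) = Cmp x y z
  Below x y nothing  = ⊥

  -- The second summand is w - u; the equation w = u + (w - u) is part of the
  -- definition so that it is checked by evaluation rather than derived from
  -- the group laws of ℤ/nℤ.
  SumOf : D → D → Fin n → Set
  SumOf x y w = ∃[ u ] (label u ≡ just x × label (w -ₙ u) ≡ just y × w ≡ u +ₙ (w -ₙ u))

  record IsCyclicLabelling : Set where
    field
      label-zero     : label zeroₙ ≡ nothing
      label-nonzero  : ∀ u → u ≢ zeroₙ → ∃[ x ] label u ≡ just x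
      label-onto     : ∀ x → ∃[ u ] label u ≡ just x
      label-neg      : ∀ u → label (-ₙ u) ≡ Maybe.map conv (label u)
      sum-composable : ∀ u v → Composable (label u) (label v) (label (u +ₙ v))
      below-sumOf    : ∀ x y w → Below x y (label w) → SumOf x y w

  module _ (conv-involutive : ∀ x → conv (conv x) ≡ x) (L : IsCyclicLabelling) where
    open IsCyclicLabelling L
    open Equivalence

    map-conv-≡just : ∀ m x → Maybe.map conv m ≡ just x → m ≡ just (conv x)
    map-conv-≡just (just y) x eq =
      cong just (trans (sym (conv-involutive y)) (cong conv (just-injective eq)))

    converse-label : ∀ x u → label u ≡ just (conv x) ⇔ label (-ₙ u) ≡ just x
    converse-label x u = mk⇔ conv-label⇒neg-label neg-label⇒conv-label
      where
      open ≡-Reasoning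
      conv-label⇒neg-label : label u ≡ just (conv x) → label (-ₙ u) ≡ just x
      conv-label⇒neg-label eq = begin
        label (-ₙ u)              ≡⟨ label-neg u ⟩
        Maybe.map conv (label u)  ≡⟨ cong (Maybe.map conv) eq ⟩
        just (conv (conv x))      ≡⟨ cong just (conv-involutive x) ⟩
        just x                    ∎
      neg-label⇒conv-label : label (-ₙ u) ≡ just x → label u ≡ just (conv x)
      neg-label⇒conv-label eq = map-conv-≡just (label u) x (trans (sym (label-neg u)) eq)

    zero∉S : ∀ x → zeroₙ ∉ S x
    zero∉S x 0∈x with () ← trans (sym label-zero) (to (∈S⇔ x zeroₙ) 0∈x)

    composition : ∀ x y w → w ≢ zeroₙ →
      (∃[ u ] ∃[ v ] (u ∈ S x × v ∈ S y × w ≡ u +ₙ v)) ⇔ (∃[ z ] (Cmp x y z × w ∈ S z))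
    composition x y w w≢0 = mk⇔ sum⇒below below⇒sum
      where
      sum⇒below : ∃[ u ] ∃[ v ] (u ∈ S x × v ∈ S y × w ≡ u +ₙ v) → ∃[ z ] (Cmp x y z × w ∈ S z)
      sum⇒below (u , v , u∈x , v∈y , refl) with label-nonzero w w≢0
      ... | z , lw = z , composable-just (to (∈S⇔ x u) u∈x) (to (∈S⇔ y v) v∈y) lw (sum-composable u v)
                       , from (∈S⇔ z w) lw
      below⇒sum : ∃[ z ] (Cmp x y z × w ∈ S z) → ∃[ u ] ∃[ v ] (u ∈ S x × v ∈ S y × w ≡ u +ₙ v)
      below⇒sum (z , xyz , w∈z) with below-sumOf x y w (subst (Below x y) (sym (to (∈S⇔ z w) w∈z)) xyz)
      ... | u , lu , lv , w≡u+v = u , w -ₙ u , from (∈S⇔ x u) lu , from (∈S⇔ y (w -ₙ u)) lv , w≡u+v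

    cyclicGroupRep : CyclicGroupRep n D conv Cmp
    cyclicGroupRep = record
      { S           = S
      ; nonempty    = λ x → let u , lu = label-onto x in u , from (∈S⇔ x u) lu
      ; zero∉       = zero∉S
      ; cover       = λ u u≢0 → let x , lu = label-nonzero u u≢0 in x , from (∈S⇔ x u) lu
      ; disjoint    = λ x y u u∈x u∈y →
                        just-injective (trans (sym (to (∈S⇔ x u) u∈x)) (to (∈S⇔ y u) u∈y))
      ; converse    = λ x u →
                        ⇔.trans (∈S⇔ (conv x) u) (⇔.trans (converse-label x u) (⇔.sym (∈S⇔ x (-ₙ u))))
      ; composition = composition
      }

  module _ (Cmp? : ∀ x y z → Dec (Cmp x y z))
           (∀? : ∀ {P : Pred D 0ℓ} → Decidable P → Dec (∀ x → P x)) where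

    is-just? : (m : Maybe D) → Dec (∃[ x ] m ≡ just x)
    is-just? (just x) = yes (x , refl)
    is-just? nothing  = no λ ()

    composable? : ∀ p q s → Dec (Composable p q s)
    composable? (just x) (just y) (just z) = Cmp? x y z
    composable? (just _) (just _) nothing  = yes _
    composable? (just _) nothing  _        = yes _
    composable? nothing  _        _        = yes _

    below? : ∀ x y m → Dec (Below x y m)
    below? x y (just z) = Cmp? x y z
    below? x y nothing  = no λ ()

    sumOf? : ∀ x y w → Dec (SumOf x y w)
    sumOf? x y w = any? λ u →
      label u ≟ᴹ just x ×-dec label (w -ₙ u) ≟ᴹ just y ×-dec w ≟ᶠ u +ₙ (w -ₙ u)

    isCyclicLabelling? : Dec IsCyclicLabelling
    isCyclicLabelling? = map′
      (λ (z , nz , onto , neg , comp , dec) → record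
        { label-zero = z ; label-nonzero = nz ; label-onto = onto
        ; label-neg = neg ; sum-composable = comp ; below-sumOf = dec })
      (λ L → let open IsCyclicLabelling L in
        label-zero , label-nonzero , label-onto , label-neg , sum-composable , below-sumOf)
      (      label zeroₙ ≟ᴹ nothing
      ×-dec all? (λ u → ¬? (u ≟ᶠ zeroₙ) →-dec is-just? (label u))
      ×-dec ∀? (λ x → any? λ u → label u ≟ᴹ just x)
      ×-dec all? (λ u → label (-ₙ u) ≟ᴹ Maybe.map conv (label u))
      ×-dec all? (λ u → all? λ v → composable? (label u) (label v) (label (u +ₙ v)))
      ×-dec ∀? (λ x → ∀? λ y → all? λ w → below? x y (label w) →-dec sumOf? x y w))

_≟_ : DecidableEquality Atom
a  ≟ a  = yes refl
a  ≟ b  = no λ ()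
a  ≟ r  = no λ ()
a  ≟ r˘ = no λ ()
b  ≟ a  = no λ ()
b  ≟ b  = yes refl
b  ≟ r  = no λ ()
b  ≟ r˘ = no λ ()
r  ≟ a  = no λ ()
r  ≟ b  = no λ ()
r  ≟ r  = yes refl
r  ≟ r˘ = no λ ()
r˘ ≟ a  = no λ ()
r˘ ≟ b  = no λ ()
r˘ ≟ r  = no λ ()
r˘ ≟ r˘ = yes refl

all-atoms? : ∀ {P : Pred Atom 0ℓ} → Decidable P → Dec (∀ x → P x)
all-atoms? P? = map′
  (λ { (pa , pb , pr , pr˘) a → pa ; (pa , pb , pr , pr˘) b → pb
     ; (pa , pb , pr , pr˘) r → pr ; (pa , pb , pr , pr˘) r˘ → pr˘ })
  (λ ∀P → ∀P a , ∀P b , ∀P r , ∀P r˘)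
  (P? a ×-dec P? b ×-dec P? r ×-dec P? r˘)

conv-involutive : ∀ x → conv (conv x) ≡ x
conv-involutive a  = refl
conv-involutive b  = refl
conv-involutive r  = refl
conv-involutive r˘ = refl

Cmp1314? : ∀ x y z → Dec (Cmp1314 x y z)
Cmp1314? x y z = ¬? ((x ≟ a ×-dec y ≟ a ×-dec z ≟ a) ⊎-dec (x ≟ b ×-dec y ≟ b ×-dec z ≟ b))

-- Entry k is the label of the residue k + 1.  The labelling is constant on the
-- cosets of the subgroup {1, 20, 30, 32, 37, 45, 48} of order 7 in (ℤ/71ℤ)ˣ:
-- the label of 7ᵏ (7 is a primitive root) is entry k mod 10 of
-- r r˘ a r b r˘ r a r˘ b, and since 7³⁵ ≡ -1, negation swaps r and r˘ and
-- fixes a and b.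
labels : Vec Atom 70
labels =
  r  ∷ r  ∷ r  ∷ a  ∷ r˘ ∷ a  ∷ r˘ ∷ r˘ ∷ a  ∷ b  ∷
  r˘ ∷ r˘ ∷ b  ∷ a  ∷ b  ∷ b  ∷ b  ∷ r˘ ∷ r  ∷ r  ∷
  a  ∷ a  ∷ r˘ ∷ b  ∷ r  ∷ r˘ ∷ r˘ ∷ r  ∷ r˘ ∷ r  ∷
  r˘ ∷ r  ∷ a  ∷ r˘ ∷ b  ∷ b  ∷ r  ∷ a  ∷ r˘ ∷ r  ∷
  r˘ ∷ r  ∷ r˘ ∷ r  ∷ r  ∷ r˘ ∷ b  ∷ r  ∷ a  ∷ a  ∷
  r˘ ∷ r˘ ∷ r  ∷ b  ∷ b  ∷ b  ∷ a  ∷ b  ∷ r  ∷ r  ∷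
  b  ∷ a  ∷ r  ∷ r  ∷ a  ∷ r  ∷ a  ∷ r˘ ∷ r˘ ∷ r˘ ∷ []

label1314 : Fin 71 → Maybe Atom
label1314 zero    = nothing
label1314 (suc u) = just (lookup labels u)

open CyclicLabelling _≟_ conv Cmp1314 label1314

mainTheorem6 : CyclicGroupRep 71 Atom conv Cmp1314
mainTheorem6 = cyclicGroupRep conv-involutive (from-yes (isCyclicLabelling? Cmp1314? all-atoms?))
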